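{- Let $G$ be a finite simple graph on $t\ge 1$ vertices. Let $\mathcal{H}(G)$ be the set of all graphs $H$ on the vertex set $\{1,2,\dots,t\}$ that are isomorphic to $G$ (labelled graphs), and for $H\in\mathcal{H}(G)$ and $i\in\{1,\dots,t\}$ let $d_i(H)$ be the number of neighbours of $i$ in $H$ that lie in $\{1,\dots,i-1\}$. Then \[ \mathcal{L}(G)=\sum_{H\in\mathcal{H}(G)}\frac{1}{t!\prod_{i=1}^{t}\binom{i-1}{d_i(H)}}. \]
   Context: Random graph process ("construction"): start with $G_1$, the graph with the single vertex $1$ and no edges. For $t\ge 2$, the graph $G_t$ on vertex set $\{1,\dots,t\}$ is obtained from $G_{t-1}$ (on vertex set $\{1,\dots,t-1\}$) as follows, independently of all earlier choices: choose an integer $k\in\{0,1,\dots,t-1\}$ uniformly at random; then choose a $k$-element subset $S\subseteq\{1,\dots,t-1\}$ uniformly at random among all $\binom{t-1}{k}$ such subsets; then add the new vertex $t$ and the edges $\{s,t\}$ for all $s\in S$. For a finite simple graph $G$ on $t$ vertices, its (graph) likelihood is $\mathcal{L}(G):=\Pr[G_t\cong G]$. (The paper phrases the sum as over "path constructions" of $G$: sequences $(H_1,\dots,H_t)$ with $H_i$ the subgraph induced on the first $i$ added vertices and $H_t\cong G$; these correspond exactly to the labelled graphs in $\mathcal{H}(G)$, and $d_i$ is the degree of the $i$-th added vertex in $H_i$.) -}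

module Defs where

open import Function using (_∘_)
open import Data.Bool using (Bool; true; false)
open import Data.Bool.Properties using () renaming (_≟_ to _≟ᵇ_)
open import Data.Nat using (ℕ; zero; suc)
import Data.Nat as ℕ
import Data.Nat.Properties as ℕₚ
open import Data.Nat.Combinatorics using (_C_)
open import Data.Fin using (Fin; zero; suc; toℕ) renaming (_<_ to _<ᶠ_)
open import Data.Fin.Properties using (any?; all?) renaming (_≟_ to _≟ᶠ_; _<?_ to _<ᶠ?_)
open import Data.Fin.Subset using (Subset; ∣_∣)
open import Data.Vec using (Vec; []; _∷_; lookup; tabulate; _∷ʳ_; zipWith)
open import Data.Vec.Properties using (lookup∘tabulate)
open import Data.List using (List; []; _∷_; [_]; map; concatMap; filter; length; foldr; upTo; allFin; cartesianProductWith)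
open import Data.List.Relation.Unary.Any as Any using (Any; here; there; satisfied)
import Data.List.Relation.Unary.Any
open import Data.List.Membership.Propositional using (_∈_)
open import Data.List.Membership.Propositional.Properties using (∈-cartesianProductWith⁺; ∈-allFin)
open import Data.Nat.ListAction using (product)
open import Data.Integer using (+_)
open import Data.Rational using (ℚ; 0ℚ; _/_) renaming (_+_ to _+ℚ_; _*_ to _*ℚ_)
open import Data.Product using (Σ; Σ-syntax; ∃; _×_; _,_; proj₁; proj₂)
open import Relation.Nullary using (Dec; yes; no; does; ¬_)
open import Relation.Nullary.Decidable using (_×-dec_; _→-dec_)
open import Relation.Unary using (Decidable)
open import Relation.Binary.PropositionalEquality using (_≡_; refl; sym; trans; cong₂; subst; _≗_)

-- Labelled graphs on the vertex set Fin t (vertex k ↔ paper's vertex k+1),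
-- given by their adjacency matrix.

Adj : ℕ → Set
Adj t = Vec (Vec Bool t) t

edge : ∀ {t} → Adj t → Fin t → Fin t → Bool
edge M i j = lookup (lookup M i) j

IsSimple : ∀ {t} → Adj t → Set
IsSimple M = (∀ i j → edge M i j ≡ edge M j i) × (∀ i → edge M i i ≡ false)

IsBijection : ∀ {t} → (Fin t → Fin t) → Set
IsBijection f = (∀ i j → f i ≡ f j → i ≡ j) × (∀ y → ∃ λ x → f x ≡ y)

Preserves : ∀ {t} → Adj t → Adj t → (Fin t → Fin t) → Set
Preserves M N f = ∀ i j → edge N (f i) (f j) ≡ edge M i j

_≅_ : ∀ {t} → Adj t → Adj t → Set
M ≅ N = Σ[ f ∈ (Fin _ → Fin _) ] (IsBijection f × Preserves M N f)

vecs : ∀ {A : Set} (n : ℕ) → List A → List (Vec A n)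
vecs zero xs = [ [] ]
vecs (suc n) xs = cartesianProductWith _∷_ xs (vecs n xs)

∈-vecs : ∀ {A : Set} {n} {xs : List A} (v : Vec A n) → (∀ i → lookup v i ∈ xs) → v ∈ vecs n xs
∈-vecs [] _ = here refl
∈-vecs (x ∷ v) h = ∈-cartesianProductWith⁺ _∷_ (h zero) (∈-vecs v (h ∘ suc))

private
  lose : ∀ {A : Set} {P : A → Set} {x : A} {xs : List A} → x ∈ xs → P x → Any P xs
  lose {P = P} m p = Any.map (λ e → subst P e p) m

any-fun? : ∀ {n m} (P : (Fin n → Fin m) → Set) → (∀ {f g} → f ≗ g → P f → P g) →
           (∀ f → Dec (P f)) → Dec (∃ P)
any-fun? {n} {m} P resp P? with Any.any? (λ v → P? (lookup v)) (vecs n (allFin m))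
... | yes a = yes (lookup (proj₁ (satisfied a)) , proj₂ (satisfied a))
... | no ¬a = no λ { (f , p) → ¬a (lose (∈-vecs (tabulate f) (λ i → ∈-allFin _))
                                        (resp (λ i → sym (lookup∘tabulate f i)) p)) }

_≅?_ : ∀ {t} (M N : Adj t) → Dec (M ≅ N)
_≅?_ {t} M N = any-fun? (λ f → IsBijection f × Preserves M N f) resp dec
  where
  resp : ∀ {f g} → f ≗ g → IsBijection f × Preserves M N f → IsBijection g × Preserves M N g
  resp {f} {g} eq ((inj , surj) , pres) =
    ((λ i j e → inj i j (trans (eq i) (trans e (sym (eq j))))) ,
     (λ y → proj₁ (surj y) , trans (sym (eq (proj₁ (surj y)))) (proj₂ (surj y)))) ,
    (λ i j → trans (cong₂ (edge N) (sym (eq i)) (sym (eq j))) (pres i j))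
  dec : ∀ g → Dec (IsBijection g × Preserves M N g)
  dec g = ((all? λ i → all? λ j → (g i ≟ᶠ g j) →-dec (i ≟ᶠ j)) ×-dec
           (all? λ y → any? λ x → g x ≟ᶠ y)) ×-dec
          (all? λ i → all? λ j → edge N (g i) (g j) ≟ᵇ edge M i j)

allAdj : (t : ℕ) → List (Adj t)
allAdj t = vecs t (vecs t (true ∷ false ∷ []))

recip : ℕ → ℚ            -- 1/n, with the convention 1/0 = 0 (never used at 0 here)
recip zero = 0ℚ
recip (suc n) = + 1 / suc n

sumℚ : List ℚ → ℚ
sumℚ = foldr _+ℚ_ 0ℚ

Dist : Set → Set
Dist A = List (ℚ × A)

return : ∀ {A : Set} → A → Dist A
return a = [ (+ 1 / 1 , a) ]

bind : ∀ {A B : Set} → Dist A → (A → Dist B) → Dist B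
bind d f = concatMap (λ { (p , a) → map (λ { (q , b) → (p *ℚ q , b) }) (f a) }) d

uniform : ∀ {A : Set} → List A → Dist A
uniform xs = map (λ x → (recip (length xs) , x)) xs

Pr : ∀ {A : Set} → Dist A → (P : A → Set) → Decidable P → ℚ
Pr [] P P? = 0ℚ
Pr ((p , a) ∷ d) P P? with does (P? a)
... | true = p +ℚ Pr d P P?
... | false = Pr d P P?

subsetsOfSize : (m k : ℕ) → List (Subset m)
subsetsOfSize m k = filter (λ S → ∣ S ∣ ℕ.≟ k) (vecs m (true ∷ false ∷ []))

-- add a new last vertex adjacent exactly to the vertices in S
extend : ∀ {m} → Adj m → Subset m → Adj (suc m)
extend M S = zipWith (λ row s → row ∷ʳ s) M S ∷ʳ (S ∷ʳ false)

step : (m : ℕ) → Adj m → Dist (Adj (suc m))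
step m M = bind (uniform (upTo (suc m))) λ k →
           bind (uniform (subsetsOfSize m k)) λ S → return (extend M S)

-- distribution of G_t  (process 1 = G_1, the single vertex graph)
process : (t : ℕ) → Dist (Adj t)
process zero = return []
process (suc m) = bind (process m) (step m)

likelihood : ∀ {t} → Adj t → ℚ
likelihood {t} G = Pr (process t) (λ H → H ≅ G) (λ H → H ≅? G)

ℋ : ∀ {t} → Adj t → List (Adj t)
ℋ {t} G = filter (λ H → H ≅? G) (allAdj t)

backDeg : ∀ {t} → Adj t → Fin t → ℕ
backDeg {t} H i = length (filter (λ j → (j <ᶠ? i) ×-dec (edge H i j ≟ᵇ true)) (allFin t))

-- 1 / ( t! · ∏_i binom(i-1, d_i(H)) )   (0-based vertex i has toℕ i earlier vertices)
weight : ∀ {t} → Adj t → ℚ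
weight {t} H = recip ((t ℕ.!) ℕ.* product (map (λ i → toℕ i C backDeg H i) (allFin t)))

-- Every simple graph H on m + 1 vertices is, uniquely, the extension of its restriction M to the
-- first m vertices by a new last vertex adjacent to S = its last column, and the back-degree of
-- that vertex is ∣ S ∣.  One step of the process produces exactly this extension from M with
-- probability 1/(m+1) · 1/C(m, ∣ S ∣) (draw k = ∣ S ∣, then S among the k-subsets), so by
-- induction Pr[G_t = H] = 1/(t! ∏ᵢ C(i, d_i(H))), vertices numbered from 0, for every labelled
-- simple H.  The likelihood is the sum of these probabilities over the labelled graphs H ≅ G,
-- all of which are simple.

module Submission where

open import Defs
open import Algebra.Bundles using (CommutativeMonoid)
open import Data.Bool using (true; false; if_then_else_)
import Data.Bool.Properties as Boolₚ
open import Data.Nat as ℕ using (ℕ; zero; suc; _≤_; s≤s; _!)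
import Data.Nat.Properties as ℕₚ
open import Data.Nat.Coprimality using (1-coprimeTo)
open import Data.Nat.Combinatorics using (_C_; nCk+nC[k+1]≡[n+1]C[k+1])
open import Data.Nat.ListAction using (product)
open import Data.Nat.ListAction.Properties using (product-++)
open import Data.Nat.Solver using (module +-*-Solver)
open import Data.Fin as Fin using (Fin; zero; suc; toℕ; inject₁; fromℕ)
import Data.Fin.Properties as Finₚ
open import Data.Fin.Subset using (Subset; ∣_∣; _∈_)
open import Data.Fin.Subset.Properties using (∣p∣≤n; _∈?_)
open import Data.Integer using (+_)
open import Data.Rational using (ℚ; 0ℚ; 1ℚ; mkℚ) renaming (_+_ to _+ℚ_; _*_ to _*ℚ_)
import Data.Rational.Properties as ℚₚ
open import Algebra.Properties.CommutativeSemigroup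
  (CommutativeMonoid.commutativeSemigroup ℚₚ.+-0-commutativeMonoid) using (interchange)
open import Algebra.Properties.CommutativeSemigroup
  (CommutativeMonoid.commutativeSemigroup ℚₚ.*-1-commutativeMonoid) using (x∙yz≈y∙xz)
open import Data.Vec using (Vec; []; _∷_; lookup; tabulate; _∷ʳ_; zipWith)
import Data.Vec.Properties as Vecₚ
open import Data.List using (List; []; _∷_; [_]; map; filter; length; _++_; concatMap; upTo; allFin; cartesianProductWith)
import Data.List as List
import Data.List.Properties as Listₚ
import Data.List.Relation.Unary.All as All
open import Data.Product as Product using (_×_; _,_; proj₁; proj₂; uncurry)
open import Function using (_∘_; id)
open import Function.Bundles using (_⇔_; mk⇔)
open import Relation.Nullary using (Dec; yes; no; does; ¬_; contradiction)
open import Relation.Nullary.Decidable using (_×-dec_; ⊥-dec; does-⇔)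
open import Relation.Unary using (Decidable)
open import Relation.Binary.Definitions using (DecidableEquality)
open import Relation.Binary.PropositionalEquality using (_≡_; refl; sym; trans; cong; cong₂; subst; subst₂; module ≡-Reasoning)

private
  variable
    A B : Set

recip-suc : ∀ a → recip (suc a) ≡ mkℚ (+ 1) a (1-coprimeTo (suc a))
recip-suc a = ℚₚ.normalize-coprime (1-coprimeTo (suc a))

-- 1/(a+1) and 1/(b+1) are already reduced, so their product computes to 1/((a+1)(b+1));
-- the convention 1/0 = 0 makes the identity hold when a factor is 0.
recip-* : ∀ a b → recip (a ℕ.* b) ≡ recip a *ℚ recip b
recip-* zero    b       = sym (ℚₚ.*-zeroˡ (recip b))
recip-* (suc a) zero    = trans (cong recip (ℕₚ.*-zeroʳ a)) (sym (ℚₚ.*-zeroʳ (recip (suc a))))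
recip-* (suc a) (suc b) rewrite recip-suc a | recip-suc b = refl

𝟙 : Dec A → ℚ
𝟙 a? = if does a? then 1ℚ else 0ℚ

𝟙-yes : (a? : Dec A) → A → 𝟙 a? ≡ 1ℚ
𝟙-yes (yes _) _ = refl
𝟙-yes (no ¬a) a = contradiction a ¬a

𝟙-no : (a? : Dec A) → ¬ A → 𝟙 a? ≡ 0ℚ
𝟙-no (yes a) ¬a = contradiction a ¬a
𝟙-no (no _)  _  = refl

𝟙-⇔ : A ⇔ B → (a? : Dec A) (b? : Dec B) → 𝟙 a? ≡ 𝟙 b?
𝟙-⇔ A⇔B a? b? = cong (λ b → if b then 1ℚ else 0ℚ) (does-⇔ A⇔B a? b?)

𝟙-≟-sym : (_≟_ : DecidableEquality A) (x y : A) → 𝟙 (x ≟ y) ≡ 𝟙 (y ≟ x)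
𝟙-≟-sym _≟_ x y = 𝟙-⇔ (mk⇔ sym sym) (x ≟ y) (y ≟ x)

𝟙-× : (a? : Dec A) (b? : Dec B) → 𝟙 (a? ×-dec b?) ≡ 𝟙 a? *ℚ 𝟙 b?
𝟙-× (yes _) b? = sym (ℚₚ.*-identityˡ (𝟙 b?))
𝟙-× (no _)  b? = sym (ℚₚ.*-zeroˡ (𝟙 b?))

∑ : List A → (A → ℚ) → ℚ
∑ xs f = sumℚ (map f xs)

syntax ∑ xs (λ x → e) = ∑[ x ∈ xs ] e

∑-cong : ∀ (xs : List A) {f g : A → ℚ} → (∀ x → f x ≡ g x) → ∑ xs f ≡ ∑ xs g
∑-cong []       f≗g = refl
∑-cong (x ∷ xs) f≗g = cong₂ _+ℚ_ (f≗g x) (∑-cong xs f≗g)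

∑-0 : ∀ (xs : List A) → ∑[ x ∈ xs ] 0ℚ ≡ 0ℚ
∑-0 []       = refl
∑-0 (x ∷ xs) = cong (0ℚ +ℚ_) (∑-0 xs)

∑-+ : ∀ (xs : List A) (f g : A → ℚ) → ∑[ x ∈ xs ] (f x +ℚ g x) ≡ ∑ xs f +ℚ ∑ xs g
∑-+ []       f g = refl
∑-+ (x ∷ xs) f g = trans (cong ((f x +ℚ g x) +ℚ_) (∑-+ xs f g)) (interchange (f x) (g x) _ _)

∑-*ˡ : ∀ (xs : List A) (c : ℚ) (f : A → ℚ) → ∑[ x ∈ xs ] (c *ℚ f x) ≡ c *ℚ ∑ xs f
∑-*ˡ []       c f = sym (ℚₚ.*-zeroʳ c)
∑-*ˡ (x ∷ xs) c f = trans (cong (c *ℚ f x +ℚ_) (∑-*ˡ xs c f)) (sym (ℚₚ.*-distribˡ-+ c (f x) _))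

∑-++ : ∀ (xs ys : List A) (f : A → ℚ) → ∑ (xs ++ ys) f ≡ ∑ xs f +ℚ ∑ ys f
∑-++ []       ys f = sym (ℚₚ.+-identityˡ _)
∑-++ (x ∷ xs) ys f = trans (cong (f x +ℚ_) (∑-++ xs ys f)) (sym (ℚₚ.+-assoc (f x) _ _))

∑-map : ∀ (xs : List A) (h : A → B) (f : B → ℚ) → ∑ (map h xs) f ≡ ∑ xs (f ∘ h)
∑-map []       h f = refl
∑-map (x ∷ xs) h f = cong (f (h x) +ℚ_) (∑-map xs h f)

∑-concatMap : ∀ (xs : List A) (g : A → List B) (f : B → ℚ) → ∑ (concatMap g xs) f ≡ ∑[ x ∈ xs ] ∑ (g x) f
∑-concatMap []       g f = refl
∑-concatMap (x ∷ xs) g f = trans (∑-++ (g x) (concatMap g xs) f) (cong (∑ (g x) f +ℚ_) (∑-concatMap xs g f))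

∑-cartesianProductWith : ∀ {C : Set} (h : A → B → C) (xs : List A) (ys : List B) (f : C → ℚ) →
  ∑ (cartesianProductWith h xs ys) f ≡ ∑[ x ∈ xs ] ∑[ y ∈ ys ] f (h x y)
∑-cartesianProductWith h []       ys f = refl
∑-cartesianProductWith h (x ∷ xs) ys f =
  trans (∑-++ (map (h x) ys) (cartesianProductWith h xs ys) f)
        (cong₂ _+ℚ_ (∑-map ys (h x) f) (∑-cartesianProductWith h xs ys f))

∑-comm : ∀ (xs : List A) (ys : List B) (f : A → B → ℚ) →
  ∑[ x ∈ xs ] ∑[ y ∈ ys ] f x y ≡ ∑[ y ∈ ys ] ∑[ x ∈ xs ] f x y
∑-comm []       ys f = sym (∑-0 ys)
∑-comm (x ∷ xs) ys f =
  trans (cong (∑ ys (f x) +ℚ_) (∑-comm xs ys f)) (sym (∑-+ ys (f x) λ y → ∑[ x ∈ xs ] f x y))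

∑-filter : ∀ {P : A → Set} (P? : Decidable P) (xs : List A) (f : A → ℚ) →
  ∑ (filter P? xs) f ≡ ∑[ x ∈ xs ] (𝟙 (P? x) *ℚ f x)
∑-filter P? []       f = refl
∑-filter P? (x ∷ xs) f with P? x
... | yes _ = cong₂ _+ℚ_ (sym (ℚₚ.*-identityˡ (f x))) (∑-filter P? xs f)
... | no _  = trans (∑-filter P? xs f)
                    (sym (trans (cong (_+ℚ _) (ℚₚ.*-zeroˡ (f x))) (ℚₚ.+-identityˡ _)))

∑-filter-cong : ∀ {P : A → Set} (P? : Decidable P) (xs : List A) {f g : A → ℚ} →
  (∀ x → P x → f x ≡ g x) → ∑ (filter P? xs) f ≡ ∑ (filter P? xs) g
∑-filter-cong P? []       f≗g = refl
∑-filter-cong P? (x ∷ xs) f≗g with P? x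
... | yes px = cong₂ _+ℚ_ (f≗g x px) (∑-filter-cong P? xs f≗g)
... | no _   = ∑-filter-cong P? xs f≗g

multiplicity : DecidableEquality A → List A → A → ℚ
multiplicity _≟_ xs a = ∑[ x ∈ xs ] 𝟙 (x ≟ a)

Enumerates : DecidableEquality A → List A → Set
Enumerates _≟_ xs = ∀ a → multiplicity _≟_ xs a ≡ 1ℚ

∑-*-𝟙≟ : ∀ (_≟_ : DecidableEquality A) xs (f : A → ℚ) a →
  ∑[ x ∈ xs ] (f x *ℚ 𝟙 (x ≟ a)) ≡ f a *ℚ multiplicity _≟_ xs a
∑-*-𝟙≟ _≟_ xs f a = trans (∑-cong xs at-a) (∑-*ˡ xs (f a) λ x → 𝟙 (x ≟ a))
  where
  at-a : ∀ x → f x *ℚ 𝟙 (x ≟ a) ≡ f a *ℚ 𝟙 (x ≟ a)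
  at-a x with x ≟ a
  ... | yes refl = refl
  ... | no _     = trans (ℚₚ.*-zeroʳ (f x)) (sym (ℚₚ.*-zeroʳ (f a)))

multiplicity-filter : ∀ (_≟_ : DecidableEquality A) {P : A → Set} (P? : Decidable P) xs a →
  multiplicity _≟_ (filter P? xs) a ≡ 𝟙 (P? a) *ℚ multiplicity _≟_ xs a
multiplicity-filter _≟_ P? xs a =
  trans (∑-filter P? xs _) (∑-*-𝟙≟ _≟_ xs (𝟙 ∘ P?) a)

vecs-enumerates : ∀ (_≟_ : DecidableEquality A) {xs} → Enumerates _≟_ xs →
  ∀ n → Enumerates (Vecₚ.≡-dec _≟_) (vecs n xs)
vecs-enumerates _≟_ xs-enum zero    []      = refl
vecs-enumerates _≟_ {xs} xs-enum (suc n) (y ∷ v) = begin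
  multiplicity _≟ᵛ_ (cartesianProductWith _∷_ xs V) (y ∷ v)
    ≡⟨ ∑-cartesianProductWith _∷_ xs V (λ w → 𝟙 (w ≟ᵛ (y ∷ v))) ⟩
  ∑[ x ∈ xs ] ∑[ w ∈ V ] 𝟙 ((x ≟ y) ×-dec (w ≟ᵛ v))
    ≡⟨ ∑-cong xs (λ x → trans (∑-cong V λ w → 𝟙-× (x ≟ y) (w ≟ᵛ v))
                              (trans (∑-*ˡ V (𝟙 (x ≟ y)) _) (ℚₚ.*-comm (𝟙 (x ≟ y)) _))) ⟩
  ∑[ x ∈ xs ] (multiplicity _≟ᵛ_ V v *ℚ 𝟙 (x ≟ y))
    ≡⟨ ∑-*-𝟙≟ _≟_ xs (λ _ → multiplicity _≟ᵛ_ V v) y ⟩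
  multiplicity _≟ᵛ_ V v *ℚ multiplicity _≟_ xs y
    ≡⟨ cong₂ _*ℚ_ (vecs-enumerates _≟_ xs-enum n v) (xs-enum y) ⟩
  1ℚ ∎
  where
  open ≡-Reasoning
  _≟ᵛ_ : ∀ {k} → DecidableEquality (Vec _ k)
  _≟ᵛ_ = Vecₚ.≡-dec _≟_
  V = vecs n xs

bools-enumerate : Enumerates Boolₚ._≟_ (true ∷ false ∷ [])
bools-enumerate true  = refl
bools-enumerate false = refl

multiplicity-upTo : ∀ n s → multiplicity ℕₚ._≟_ (upTo n) s ≡ 𝟙 (s ℕₚ.<? n)
multiplicity-upTo zero    s = refl
multiplicity-upTo (suc n) s = begin
  multiplicity _≟_ (upTo (suc n)) s      ≡⟨ cong (λ ks → multiplicity _≟_ ks s) (sym (Listₚ.applyUpTo-∷ʳ id n)) ⟩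
  multiplicity _≟_ (upTo n ++ [ n ]) s   ≡⟨ ∑-++ (upTo n) [ n ] _ ⟩
  multiplicity _≟_ (upTo n) s +ℚ (𝟙 (n ≟ s) +ℚ 0ℚ)
    ≡⟨ cong₂ _+ℚ_ (multiplicity-upTo n s) (ℚₚ.+-identityʳ _) ⟩
  𝟙 (s <? n) +ℚ 𝟙 (n ≟ s)                ≡⟨ new-element (s ≟ n) ⟩
  𝟙 (s <? suc n) ∎
  where
  open ≡-Reasoning
  open ℕₚ using (_≟_; _<?_)
  new-element : Dec (s ≡ n) → 𝟙 (s <? n) +ℚ 𝟙 (n ≟ s) ≡ 𝟙 (s <? suc n)
  new-element (yes refl) = trans (cong₂ _+ℚ_ (𝟙-no (s <? s) (ℕₚ.<-irrefl refl)) (𝟙-yes (s ≟ s) refl))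
                                 (sym (𝟙-yes (s <? suc s) (ℕₚ.n<1+n s)))
  new-element (no s≢n) = trans (cong (𝟙 (s <? n) +ℚ_) (𝟙-no (n ≟ s) (s≢n ∘ sym)))
    (trans (ℚₚ.+-identityʳ _)
           (𝟙-⇔ (mk⇔ ℕₚ.m<n⇒m<1+n λ s<1+n → ℕₚ.≤∧≢⇒< (ℕ.s≤s⁻¹ s<1+n) s≢n) (s <? n) (s <? suc n)))

length-filter-map : ∀ {P : B → Set} {Q : A → Set} (P? : Decidable P) (Q? : Decidable Q) (f : A → B) →
  (∀ x → does (P? (f x)) ≡ does (Q? x)) → ∀ xs → length (filter P? (map f xs)) ≡ length (filter Q? xs)
length-filter-map P? Q? f same []       = refl
length-filter-map P? Q? f same (x ∷ xs) with P? (f x) | Q? x | same x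
... | yes _ | yes _ | _  = cong suc (length-filter-map P? Q? f same xs)
... | no _  | no _  | _  = length-filter-map P? Q? f same xs
... | yes _ | no _  | ()
... | no _  | yes _ | ()

length-filter-++ : ∀ {P : A → Set} (P? : Decidable P) xs ys →
  length (filter P? (xs ++ ys)) ≡ length (filter P? xs) ℕ.+ length (filter P? ys)
length-filter-++ P? xs ys = trans (cong length (Listₚ.filter-++ P? xs ys)) (Listₚ.length-++ (filter P? xs))

length-subsetsOfSize : ∀ m k → length (subsetsOfSize m k) ≡ m C k
length-subsetsOfSize zero    zero    = refl
length-subsetsOfSize zero    (suc k) = refl
length-subsetsOfSize (suc m) k = begin
  length (filter (ofSize k) (map (true ∷_) V ++ map (false ∷_) V ++ []))
    ≡⟨ length-filter-++ (ofSize k) (map (true ∷_) V) _ ⟩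
  withFirst k ℕ.+ length (filter (ofSize k) (map (false ∷_) V ++ []))
    ≡⟨ cong (withFirst k ℕ.+_) (trans (length-filter-++ (ofSize k) (map (false ∷_) V) []) (ℕₚ.+-identityʳ _)) ⟩
  withFirst k ℕ.+ length (filter (ofSize k) (map (false ∷_) V))
    ≡⟨ cong (withFirst k ℕ.+_) (length-filter-map (ofSize k) (ofSize k) (false ∷_) (λ _ → refl) V) ⟩
  withFirst k ℕ.+ length (subsetsOfSize m k)
    ≡⟨ pascal k ⟩
  suc m C k ∎
  where
  open ≡-Reasoning
  V = vecs m (true ∷ false ∷ [])
  ofSize : ∀ {n} (k : ℕ) → Decidable (λ (S : Subset n) → ∣ S ∣ ≡ k)
  ofSize k S = ∣ S ∣ ℕₚ.≟ k
  withFirst : ℕ → ℕ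
  withFirst k = length (filter (ofSize k) (map (true ∷_) V))
  pascal : ∀ k → withFirst k ℕ.+ length (subsetsOfSize m k) ≡ suc m C k
  pascal zero = trans (cong (ℕ._+ length (subsetsOfSize m 0)) none-empty) (length-subsetsOfSize m 0)
    where
    none-empty : withFirst 0 ≡ 0
    none-empty = trans (length-filter-map (ofSize 0) (λ _ → ⊥-dec) (true ∷_) (λ _ → refl) V)
                       (cong length (Listₚ.filter-none _ (All.universal (λ _ ()) V)))
  pascal (suc k) = begin
    withFirst (suc k) ℕ.+ length (subsetsOfSize m (suc k))
      ≡⟨ cong₂ ℕ._+_ (length-filter-map (ofSize (suc k)) (ofSize k) (true ∷_) (λ _ → refl) V)
                      (length-subsetsOfSize m (suc k)) ⟩
    length (subsetsOfSize m k) ℕ.+ m C suc k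
      ≡⟨ cong (ℕ._+ m C suc k) (length-subsetsOfSize m k) ⟩
    m C k ℕ.+ m C suc k
      ≡⟨ nCk+nC[k+1]≡[n+1]C[k+1] m k ⟩
    suc m C suc k ∎

mass : ∀ {P : A → Set} → Decidable P → ℚ × A → ℚ
mass P? (p , a) = p *ℚ 𝟙 (P? a)

Pr≡∑mass : ∀ {P : A → Set} (P? : Decidable P) (d : Dist A) → Pr d P P? ≡ ∑ d (mass P?)
Pr≡∑mass P? []            = refl
Pr≡∑mass P? ((p , a) ∷ d) with P? a
... | yes _ = cong₂ _+ℚ_ (sym (ℚₚ.*-identityʳ p)) (Pr≡∑mass P? d)
... | no _  = trans (Pr≡∑mass P? d) (sym (trans (cong (_+ℚ _) (ℚₚ.*-zeroʳ p)) (ℚₚ.+-identityˡ _)))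

module _ {P : B → Set} (P? : Decidable P) where

  Pr-return : ∀ b → Pr (return b) P P? ≡ 𝟙 (P? b)
  Pr-return b = trans (Pr≡∑mass P? (return b)) (trans (ℚₚ.+-identityʳ _) (ℚₚ.*-identityˡ _))

  Pr-bind : ∀ (d : Dist A) (f : A → Dist B) →
    Pr (bind d f) P P? ≡ ∑ d (uncurry λ p a → p *ℚ Pr (f a) P P?)
  Pr-bind d f =
    trans (Pr≡∑mass P? (bind d f)) (trans (∑-concatMap d _ (mass P?)) (∑-cong d (uncurry scaled)))
    where
    open ≡-Reasoning
    scaled : ∀ p a → ∑ (map (λ qb → p *ℚ proj₁ qb , proj₂ qb) (f a)) (mass P?) ≡ p *ℚ Pr (f a) P P?
    scaled p a = begin
      ∑ (map _ (f a)) (mass P?)                        ≡⟨ ∑-map (f a) _ (mass P?) ⟩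
      ∑[ qb ∈ f a ] ((p *ℚ proj₁ qb) *ℚ 𝟙 (P? (proj₂ qb))) ≡⟨ ∑-cong (f a) (λ qb → ℚₚ.*-assoc p _ _) ⟩
      ∑[ qb ∈ f a ] (p *ℚ mass P? qb)                   ≡⟨ ∑-*ˡ (f a) p (mass P?) ⟩
      p *ℚ ∑ (f a) (mass P?)                            ≡⟨ cong (p *ℚ_) (sym (Pr≡∑mass P? (f a))) ⟩
      p *ℚ Pr (f a) P P? ∎

  Pr-bind-uniform : ∀ (xs : List A) (f : A → Dist B) →
    Pr (bind (uniform xs) f) P P? ≡ recip (length xs) *ℚ ∑[ x ∈ xs ] Pr (f x) P P?
  Pr-bind-uniform xs f = trans (Pr-bind (uniform xs) f)
    (trans (∑-map xs _ _) (∑-*ˡ xs (recip (length xs)) (λ x → Pr (f x) P P?)))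

  Pr-bind-∝ : ∀ {Q : A → Set} (Q? : Decidable Q) (c : ℚ) (f : A → Dist B) →
    (∀ a → Pr (f a) P P? ≡ c *ℚ 𝟙 (Q? a)) → ∀ d → Pr (bind d f) P P? ≡ c *ℚ Pr d Q Q?
  Pr-bind-∝ {Q = Q} Q? c f Pr-f d = begin
    Pr (bind d f) P P?                         ≡⟨ Pr-bind d f ⟩
    ∑ d (uncurry λ p a → p *ℚ Pr (f a) P P?)   ≡⟨ ∑-cong d (uncurry λ p a → trans (cong (p *ℚ_) (Pr-f a)) (x∙yz≈y∙xz p c _)) ⟩
    ∑[ pa ∈ d ] (c *ℚ mass Q? pa)              ≡⟨ ∑-*ˡ d c (mass Q?) ⟩
    c *ℚ ∑ d (mass Q?)                         ≡⟨ cong (c *ℚ_) (sym (Pr≡∑mass Q? d)) ⟩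
    c *ℚ Pr d Q Q? ∎
    where open ≡-Reasoning

Pr-total : ∀ (_≟_ : DecidableEquality A) {P : A → Set} (P? : Decidable P) (U : List A) →
  Enumerates _≟_ U → ∀ d → Pr d P P? ≡ ∑[ y ∈ filter P? U ] Pr d (_≡ y) (_≟ y)
Pr-total _≟_ {P = P} P? U U-enum d = begin
  Pr d P P?                                 ≡⟨ Pr≡∑mass P? d ⟩
  ∑ d (mass P?)                             ≡⟨ ∑-cong d (uncurry split) ⟩
  ∑[ pa ∈ d ] ∑[ y ∈ F ] mass (_≟ y) pa     ≡⟨ ∑-comm d F (λ pa y → mass (_≟ y) pa) ⟩
  ∑[ y ∈ F ] ∑ d (mass (_≟ y))              ≡⟨ ∑-cong F (λ y → sym (Pr≡∑mass (_≟ y) d)) ⟩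
  ∑[ y ∈ F ] Pr d (_≡ y) (_≟ y) ∎
  where
  open ≡-Reasoning
  F = filter P? U
  split : ∀ p a → p *ℚ 𝟙 (P? a) ≡ ∑[ y ∈ F ] (p *ℚ 𝟙 (a ≟ y))
  split p a = begin
    p *ℚ 𝟙 (P? a)                             ≡⟨ cong (p *ℚ_) (sym (trans (cong (𝟙 (P? a) *ℚ_) (U-enum a)) (ℚₚ.*-identityʳ _))) ⟩
    p *ℚ (𝟙 (P? a) *ℚ multiplicity _≟_ U a)  ≡⟨ cong (p *ℚ_) (sym (multiplicity-filter _≟_ P? U a)) ⟩
    p *ℚ multiplicity _≟_ F a                 ≡⟨ sym (∑-*ˡ F p _) ⟩
    ∑[ y ∈ F ] (p *ℚ 𝟙 (y ≟ a))               ≡⟨ ∑-cong F (λ y → cong (p *ℚ_) (𝟙-≟-sym _≟_ y a)) ⟩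
    ∑[ y ∈ F ] (p *ℚ 𝟙 (a ≟ y)) ∎

lookup-∷ʳ-inject₁ : ∀ {n} (xs : Vec A n) x i → lookup (xs ∷ʳ x) (inject₁ i) ≡ lookup xs i
lookup-∷ʳ-inject₁ (y ∷ xs) x zero    = refl
lookup-∷ʳ-inject₁ (y ∷ xs) x (suc i) = lookup-∷ʳ-inject₁ xs x i

lookup-∷ʳ-fromℕ : ∀ {n} (xs : Vec A n) x → lookup (xs ∷ʳ x) (fromℕ n) ≡ x
lookup-∷ʳ-fromℕ []       x = refl
lookup-∷ʳ-fromℕ (y ∷ xs) x = lookup-∷ʳ-fromℕ xs x

lookup-ext : ∀ {n} (u v : Vec A n) → (∀ i → lookup u i ≡ lookup v i) → u ≡ v
lookup-ext u v u≗v = trans (sym (Vecₚ.tabulate∘lookup u)) (trans (Vecₚ.tabulate-cong u≗v) (Vecₚ.tabulate∘lookup v))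

edge-ext : ∀ {t} (M N : Adj t) → (∀ i j → edge M i j ≡ edge N i j) → M ≡ N
edge-ext M N M≗N = lookup-ext M N λ i → lookup-ext _ _ (M≗N i)

data Extended {m : ℕ} : Fin (suc m) → Set where
  old : ∀ i → Extended (inject₁ i)
  new : Extended (fromℕ m)

extended : ∀ {m} (i : Fin (suc m)) → Extended i
extended {zero}  zero    = new
extended {suc m} zero    = old zero
extended {suc m} (suc i) with extended i
... | old j = old (suc j)
... | new   = new

tabulate-∷ʳ : ∀ {m} (f : Fin (suc m) → A) → List.tabulate f ≡ List.tabulate (f ∘ inject₁) List.∷ʳ f (fromℕ m)
tabulate-∷ʳ {m = zero}  f = refl
tabulate-∷ʳ {m = suc m} f = cong (f zero ∷_) (tabulate-∷ʳ (f ∘ suc))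

allFin-∷ʳ : ∀ m → allFin (suc m) ≡ map inject₁ (allFin m) List.∷ʳ fromℕ m
allFin-∷ʳ m = trans (tabulate-∷ʳ id) (cong (List._∷ʳ fromℕ m) (sym (Listₚ.map-tabulate id inject₁)))

product-allFin-suc : ∀ m (h : Fin (suc m) → ℕ) →
  product (map h (allFin (suc m))) ≡ product (map (h ∘ inject₁) (allFin m)) ℕ.* h (fromℕ m)
product-allFin-suc m h = begin
  product (map h (allFin (suc m)))                               ≡⟨ cong (product ∘ map h) (allFin-∷ʳ m) ⟩
  product (map h (map inject₁ (allFin m) ++ [ fromℕ m ]))        ≡⟨ cong product (Listₚ.map-++ h (map inject₁ (allFin m)) _) ⟩
  product (map h (map inject₁ (allFin m)) ++ [ h (fromℕ m) ])    ≡⟨ product-++ (map h (map inject₁ (allFin m))) _ ⟩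
  product (map h (map inject₁ (allFin m))) ℕ.* (h (fromℕ m) ℕ.* 1)
    ≡⟨ cong₂ ℕ._*_ (cong product (sym (Listₚ.map-∘ (allFin m)))) (ℕₚ.*-identityʳ _) ⟩
  product (map (h ∘ inject₁) (allFin m)) ℕ.* h (fromℕ m) ∎
  where open ≡-Reasoning

length-filter-allFin-suc : ∀ {m} {P : Fin (suc m) → Set} {Q : Fin m → Set} (P? : Decidable P) (Q? : Decidable Q) →
  ¬ P (fromℕ m) → (∀ j → does (P? (inject₁ j)) ≡ does (Q? j)) →
  length (filter P? (allFin (suc m))) ≡ length (filter Q? (allFin m))
length-filter-allFin-suc {m} P? Q? ¬P-new same = begin
  length (filter P? (allFin (suc m)))                        ≡⟨ cong (length ∘ filter P?) (allFin-∷ʳ m) ⟩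
  length (filter P? (map inject₁ (allFin m) ++ [ fromℕ m ]))  ≡⟨ length-filter-++ P? (map inject₁ (allFin m)) _ ⟩
  length (filter P? (map inject₁ (allFin m))) ℕ.+ length (filter P? [ fromℕ m ])
    ≡⟨ cong₂ ℕ._+_ (length-filter-map P? Q? inject₁ same (allFin m)) (cong length (Listₚ.filter-reject P? ¬P-new)) ⟩
  length (filter Q? (allFin m)) ℕ.+ 0                         ≡⟨ ℕₚ.+-identityʳ _ ⟩
  length (filter Q? (allFin m)) ∎
  where open ≡-Reasoning

length-filter-∈?-tabulate-suc : ∀ {m} x (p : Subset m) →
  length (filter (_∈? (x ∷ p)) (List.tabulate suc)) ≡ length (filter (_∈? p) (allFin m))
length-filter-∈?-tabulate-suc x p =
  trans (cong (length ∘ filter (_∈? (x ∷ p))) (sym (Listₚ.map-tabulate id suc)))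
        (length-filter-map (_∈? (x ∷ p)) (_∈? p) suc (λ _ → refl) (allFin _))

∣p∣≡length-filter : ∀ {m} (p : Subset m) → ∣ p ∣ ≡ length (filter (_∈? p) (allFin m))
∣p∣≡length-filter []          = refl
∣p∣≡length-filter (true ∷ p)  = cong suc (trans (∣p∣≡length-filter p) (sym (length-filter-∈?-tabulate-suc true p)))
∣p∣≡length-filter (false ∷ p) = trans (∣p∣≡length-filter p) (sym (length-filter-∈?-tabulate-suc false p))

module _ {m} (M : Adj m) (S : Subset m) where

  private
    row-old : ∀ i → lookup (extend M S) (inject₁ i) ≡ lookup M i ∷ʳ lookup S i
    row-old i = trans (lookup-∷ʳ-inject₁ (zipWith (λ row s → row ∷ʳ s) M S) (S ∷ʳ false) i)
                      (Vecₚ.lookup-zipWith (λ row s → row ∷ʳ s) i M S)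

    row-new : lookup (extend M S) (fromℕ m) ≡ S ∷ʳ false
    row-new = lookup-∷ʳ-fromℕ (zipWith (λ row s → row ∷ʳ s) M S) (S ∷ʳ false)

  edge-extend-old-old : ∀ i j → edge (extend M S) (inject₁ i) (inject₁ j) ≡ edge M i j
  edge-extend-old-old i j rewrite row-old i = lookup-∷ʳ-inject₁ (lookup M i) (lookup S i) j

  edge-extend-old-new : ∀ i → edge (extend M S) (inject₁ i) (fromℕ m) ≡ lookup S i
  edge-extend-old-new i rewrite row-old i = lookup-∷ʳ-fromℕ (lookup M i) (lookup S i)

  edge-extend-new-old : ∀ j → edge (extend M S) (fromℕ m) (inject₁ j) ≡ lookup S j
  edge-extend-new-old j rewrite row-new = lookup-∷ʳ-inject₁ S false j

  edge-extend-new-new : edge (extend M S) (fromℕ m) (fromℕ m) ≡ false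
  edge-extend-new-new rewrite row-new = lookup-∷ʳ-fromℕ S false

extend-injective : ∀ {m} {M M′ : Adj m} {S S′ : Subset m} → extend M S ≡ extend M′ S′ → M ≡ M′ × S ≡ S′
extend-injective {M = M} {M′} {S} {S′} eq =
  edge-ext M M′ (λ i j → trans (sym (edge-extend-old-old M S i j))
                               (trans (cong (λ H → edge H (inject₁ i) (inject₁ j)) eq) (edge-extend-old-old M′ S′ i j))) ,
  lookup-ext S S′ (λ i → trans (sym (edge-extend-old-new M S i))
                               (trans (cong (λ H → edge H (inject₁ i) (fromℕ _)) eq) (edge-extend-old-new M′ S′ i)))

dropLast : ∀ {m} → Adj (suc m) → Adj m
dropLast H = tabulate λ i → tabulate λ j → edge H (inject₁ i) (inject₁ j)

lastNeighbours : ∀ {m} → Adj (suc m) → Subset m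
lastNeighbours {m} H = tabulate λ i → edge H (inject₁ i) (fromℕ m)

edge-dropLast : ∀ {m} (H : Adj (suc m)) i j → edge (dropLast H) i j ≡ edge H (inject₁ i) (inject₁ j)
edge-dropLast H i j rewrite Vecₚ.lookup∘tabulate (λ i → tabulate λ j → edge H (inject₁ i) (inject₁ j)) i =
  Vecₚ.lookup∘tabulate _ j

lookup-lastNeighbours : ∀ {m} (H : Adj (suc m)) i → lookup (lastNeighbours H) i ≡ edge H (inject₁ i) (fromℕ m)
lookup-lastNeighbours H i = Vecₚ.lookup∘tabulate _ i

extend-dropLast : ∀ {m} (H : Adj (suc m)) → IsSimple H → extend (dropLast H) (lastNeighbours H) ≡ H
extend-dropLast {m} H (symmetric , loopless) = edge-ext _ H edges
  where
  M = dropLast H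
  S = lastNeighbours H
  edges : ∀ i j → edge (extend M S) i j ≡ edge H i j
  edges i j with extended i | extended j
  ... | old i | old j = trans (edge-extend-old-old M S i j) (edge-dropLast H i j)
  ... | old i | new   = trans (edge-extend-old-new M S i) (lookup-lastNeighbours H i)
  ... | new   | old j = trans (edge-extend-new-old M S j) (trans (lookup-lastNeighbours H j) (symmetric _ _))
  ... | new   | new   = trans (edge-extend-new-new M S) (sym (loopless _))

dropLast-simple : ∀ {m} (H : Adj (suc m)) → IsSimple H → IsSimple (dropLast H)
dropLast-simple H (symmetric , loopless) =
  (λ i j → trans (edge-dropLast H i j) (trans (symmetric _ _) (sym (edge-dropLast H j i)))) ,
  (λ i → trans (edge-dropLast H i i) (loopless _))

simple-≅ : ∀ {t} (H G : Adj t) → H ≅ G → IsSimple G → IsSimple H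
simple-≅ H G (f , _ , preserves) (symmetric , loopless) =
  (λ i j → trans (sym (preserves i j)) (trans (symmetric _ _) (preserves j i))) ,
  (λ i → trans (sym (preserves i i)) (loopless _))

earlierNeighbour? : ∀ {t} (H : Adj t) (i : Fin t) → Decidable (λ j → j Fin.< i × edge H i j ≡ true)
earlierNeighbour? H i j = (j Finₚ.<? i) ×-dec (edge H i j Boolₚ.≟ true)

backDeg-extend-old : ∀ {m} (M : Adj m) S i → backDeg (extend M S) (inject₁ i) ≡ backDeg M i
backDeg-extend-old {m} M S i =
  length-filter-allFin-suc (earlierNeighbour? (extend M S) (inject₁ i)) (earlierNeighbour? M i) new-not-earlier
    λ j → does-⇔ (same j) (earlierNeighbour? (extend M S) (inject₁ i) (inject₁ j)) (earlierNeighbour? M i j)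
  where
  new-not-earlier : ¬ (fromℕ m Fin.< inject₁ i × edge (extend M S) (inject₁ i) (fromℕ m) ≡ true)
  new-not-earlier (new<i , _) = ℕₚ.<⇒≱ new<i (Finₚ.≤fromℕ (inject₁ i))
  same : ∀ j → (inject₁ j Fin.< inject₁ i × edge (extend M S) (inject₁ i) (inject₁ j) ≡ true)
             ⇔ (j Fin.< i × edge M i j ≡ true)
  same j = mk⇔ (Product.map (subst₂ ℕ._<_ (Finₚ.toℕ-inject₁ j) (Finₚ.toℕ-inject₁ i))
                            (trans (sym (edge-extend-old-old M S i j))))
               (Product.map (subst₂ ℕ._<_ (sym (Finₚ.toℕ-inject₁ j)) (sym (Finₚ.toℕ-inject₁ i)))
                            (trans (edge-extend-old-old M S i j)))

backDeg-extend-new : ∀ {m} (M : Adj m) S → backDeg (extend M S) (fromℕ m) ≡ ∣ S ∣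
backDeg-extend-new {m} M S =
  trans (length-filter-allFin-suc (earlierNeighbour? (extend M S) (fromℕ m)) (_∈? S) (λ (new<new , _) → ℕₚ.<-irrefl refl new<new)
           λ j → does-⇔ (same j) (earlierNeighbour? (extend M S) (fromℕ m) (inject₁ j)) (j ∈? S))
        (sym (∣p∣≡length-filter S))
  where
  same : ∀ j → (inject₁ j Fin.< fromℕ m × edge (extend M S) (fromℕ m) (inject₁ j) ≡ true) ⇔ j ∈ S
  same j = mk⇔ (λ (_ , e) → Vecₚ.lookup⇒[]= j S (trans (sym (edge-extend-new-old M S j)) e))
               (λ j∈S → subst₂ ℕ._<_ (sym (Finₚ.toℕ-inject₁ j)) (sym (Finₚ.toℕ-fromℕ m)) (Finₚ.toℕ<n j) ,
                        trans (edge-extend-new-old M S j) (Vecₚ.[]=⇒lookup j∈S))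

weight-extend : ∀ {m} (M : Adj m) S → weight (extend M S) ≡ (recip (suc m) *ℚ recip (m C ∣ S ∣)) *ℚ weight M
weight-extend {m} M S = begin
  recip ((suc m ℕ.* m !) ℕ.* product (map binom′ (allFin (suc m))))
    ≡⟨ cong (λ n → recip ((suc m ℕ.* m !) ℕ.* n)) binoms ⟩
  recip ((suc m ℕ.* m !) ℕ.* (∏ ℕ.* (m C ∣ S ∣)))
    ≡⟨ cong recip (rearrange (suc m) (m !) ∏ (m C ∣ S ∣)) ⟩
  recip ((suc m ℕ.* (m C ∣ S ∣)) ℕ.* (m ! ℕ.* ∏))
    ≡⟨ recip-* (suc m ℕ.* (m C ∣ S ∣)) (m ! ℕ.* ∏) ⟩
  recip (suc m ℕ.* (m C ∣ S ∣)) *ℚ weight M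
    ≡⟨ cong (_*ℚ weight M) (recip-* (suc m) (m C ∣ S ∣)) ⟩
  (recip (suc m) *ℚ recip (m C ∣ S ∣)) *ℚ weight M ∎
  where
  open ≡-Reasoning
  binom′ : Fin (suc m) → ℕ
  binom′ i = toℕ i C backDeg (extend M S) i
  ∏ = product (map (λ i → toℕ i C backDeg M i) (allFin m))
  binoms : product (map binom′ (allFin (suc m))) ≡ ∏ ℕ.* (m C ∣ S ∣)
  binoms = trans (product-allFin-suc m binom′)
    (cong₂ ℕ._*_ (cong product (Listₚ.map-cong (λ i → cong₂ _C_ (Finₚ.toℕ-inject₁ i) (backDeg-extend-old M S i)) (allFin m)))
                 (cong₂ _C_ (Finₚ.toℕ-fromℕ m) (backDeg-extend-new M S)))
  rearrange : ∀ a f p c → (a ℕ.* f) ℕ.* (p ℕ.* c) ≡ (a ℕ.* c) ℕ.* (f ℕ.* p)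
  rearrange = solve 4 (λ a f p c → (a :* f) :* (p :* c) := (a :* c) :* (f :* p)) refl
    where open +-*-Solver

_≟ˢ_ : ∀ {m} → DecidableEquality (Subset m)
_≟ˢ_ = Vecₚ.≡-dec Boolₚ._≟_

_≟ᴬ_ : ∀ {t} → DecidableEquality (Adj t)
_≟ᴬ_ = Vecₚ.≡-dec _≟ˢ_

allAdj-enumerates : ∀ t → Enumerates _≟ᴬ_ (allAdj t)
allAdj-enumerates t = vecs-enumerates _≟ˢ_ (vecs-enumerates Boolₚ._≟_ bools-enumerate t) t

𝟙-extend-≟ : ∀ {m} (M′ M : Adj m) (S′ S : Subset m) →
  𝟙 (extend M′ S′ ≟ᴬ extend M S) ≡ 𝟙 (M′ ≟ᴬ M) *ℚ 𝟙 (S′ ≟ˢ S)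
𝟙-extend-≟ M′ M S′ S =
  trans (𝟙-⇔ (mk⇔ extend-injective λ { (refl , refl) → refl }) (extend M′ S′ ≟ᴬ extend M S) ((M′ ≟ᴬ M) ×-dec (S′ ≟ˢ S)))
        (𝟙-× (M′ ≟ᴬ M) (S′ ≟ˢ S))

multiplicity-subsetsOfSize : ∀ m k (S : Subset m) → multiplicity _≟ˢ_ (subsetsOfSize m k) S ≡ 𝟙 (k ℕₚ.≟ ∣ S ∣)
multiplicity-subsetsOfSize m k S = begin
  multiplicity _≟ˢ_ (subsetsOfSize m k) S     ≡⟨ multiplicity-filter _≟ˢ_ (λ S′ → ∣ S′ ∣ ℕₚ.≟ k) V S ⟩
  𝟙 (∣ S ∣ ℕₚ.≟ k) *ℚ multiplicity _≟ˢ_ V S  ≡⟨ cong (𝟙 (∣ S ∣ ℕₚ.≟ k) *ℚ_) (vecs-enumerates Boolₚ._≟_ bools-enumerate m S) ⟩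
  𝟙 (∣ S ∣ ℕₚ.≟ k) *ℚ 1ℚ                      ≡⟨ trans (ℚₚ.*-identityʳ _) (𝟙-≟-sym ℕₚ._≟_ ∣ S ∣ k) ⟩
  𝟙 (k ℕₚ.≟ ∣ S ∣) ∎
  where
  open ≡-Reasoning
  V = vecs m (true ∷ false ∷ [])

Pr-extendBySize : ∀ m k (M′ M : Adj m) (S : Subset m) →
  Pr (bind (uniform (subsetsOfSize m k)) λ S′ → return (extend M′ S′)) (_≡ extend M S) (_≟ᴬ extend M S)
    ≡ (recip (m C k) *ℚ 𝟙 (M′ ≟ᴬ M)) *ℚ 𝟙 (k ℕₚ.≟ ∣ S ∣)
Pr-extendBySize m k M′ M S = begin
  Pr (bind (uniform Sₖ) λ S′ → return (extend M′ S′)) (_≡ E) E?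
    ≡⟨ Pr-bind-uniform E? Sₖ (λ S′ → return (extend M′ S′)) ⟩
  recip (length Sₖ) *ℚ ∑[ S′ ∈ Sₖ ] Pr (return (extend M′ S′)) (_≡ E) E?
    ≡⟨ cong₂ _*ℚ_ (cong recip (length-subsetsOfSize m k))
                  (∑-cong Sₖ λ S′ → trans (Pr-return E? (extend M′ S′)) (𝟙-extend-≟ M′ M S′ S)) ⟩
  recip (m C k) *ℚ ∑[ S′ ∈ Sₖ ] (𝟙 (M′ ≟ᴬ M) *ℚ 𝟙 (S′ ≟ˢ S))
    ≡⟨ cong (recip (m C k) *ℚ_) (∑-*ˡ Sₖ (𝟙 (M′ ≟ᴬ M)) _) ⟩
  recip (m C k) *ℚ (𝟙 (M′ ≟ᴬ M) *ℚ multiplicity _≟ˢ_ Sₖ S)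
    ≡⟨ cong (λ q → recip (m C k) *ℚ (𝟙 (M′ ≟ᴬ M) *ℚ q)) (multiplicity-subsetsOfSize m k S) ⟩
  recip (m C k) *ℚ (𝟙 (M′ ≟ᴬ M) *ℚ 𝟙 (k ℕₚ.≟ ∣ S ∣))
    ≡⟨ sym (ℚₚ.*-assoc (recip (m C k)) _ _) ⟩
  (recip (m C k) *ℚ 𝟙 (M′ ≟ᴬ M)) *ℚ 𝟙 (k ℕₚ.≟ ∣ S ∣) ∎
  where
  open ≡-Reasoning
  Sₖ = subsetsOfSize m k
  E = extend M S
  E? = _≟ᴬ E

-- Only the draw k = ∣ S ∣, followed by the draw S′ = S, yields extend M S.
Pr-step : ∀ m (M′ M : Adj m) (S : Subset m) →
  Pr (step m M′) (_≡ extend M S) (_≟ᴬ extend M S) ≡ (recip (suc m) *ℚ recip (m C ∣ S ∣)) *ℚ 𝟙 (M′ ≟ᴬ M)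
Pr-step m M′ M S = begin
  Pr (step m M′) (_≡ E) E?
    ≡⟨ Pr-bind-uniform E? (upTo (suc m)) extendBySize ⟩
  recip (length (upTo (suc m))) *ℚ ∑[ k ∈ upTo (suc m) ] Pr (extendBySize k) (_≡ E) E?
    ≡⟨ cong₂ _*ℚ_ (cong recip (Listₚ.length-upTo (suc m))) (∑-cong (upTo (suc m)) λ k → Pr-extendBySize m k M′ M S) ⟩
  recip (suc m) *ℚ ∑[ k ∈ upTo (suc m) ] (p k *ℚ 𝟙 (k ℕₚ.≟ ∣ S ∣))
    ≡⟨ cong (recip (suc m) *ℚ_) (∑-*-𝟙≟ ℕₚ._≟_ (upTo (suc m)) p ∣ S ∣) ⟩
  recip (suc m) *ℚ (p ∣ S ∣ *ℚ multiplicity ℕₚ._≟_ (upTo (suc m)) ∣ S ∣)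
    ≡⟨ cong (λ q → recip (suc m) *ℚ (p ∣ S ∣ *ℚ q)) size-possible ⟩
  recip (suc m) *ℚ (p ∣ S ∣ *ℚ 1ℚ)
    ≡⟨ cong (recip (suc m) *ℚ_) (ℚₚ.*-identityʳ (p ∣ S ∣)) ⟩
  recip (suc m) *ℚ (recip (m C ∣ S ∣) *ℚ 𝟙 (M′ ≟ᴬ M))
    ≡⟨ sym (ℚₚ.*-assoc (recip (suc m)) (recip (m C ∣ S ∣)) (𝟙 (M′ ≟ᴬ M))) ⟩
  (recip (suc m) *ℚ recip (m C ∣ S ∣)) *ℚ 𝟙 (M′ ≟ᴬ M) ∎
  where
  open ≡-Reasoning
  E = extend M S
  E? = _≟ᴬ E
  extendBySize : ℕ → Dist (Adj (suc m))
  extendBySize k = bind (uniform (subsetsOfSize m k)) λ S′ → return (extend M′ S′)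
  p : ℕ → ℚ
  p k = recip (m C k) *ℚ 𝟙 (M′ ≟ᴬ M)
  size-possible : multiplicity ℕₚ._≟_ (upTo (suc m)) ∣ S ∣ ≡ 1ℚ
  size-possible = trans (multiplicity-upTo (suc m) ∣ S ∣) (𝟙-yes (∣ S ∣ ℕₚ.<? suc m) (s≤s (∣p∣≤n S)))

Pr-process≡weight : ∀ t (H : Adj t) → IsSimple H → Pr (process t) (_≡ H) (_≟ᴬ H) ≡ weight H
Pr-process≡weight zero    []  _        = refl
Pr-process≡weight (suc m) H H-simple =
  subst (λ H → Pr (process (suc m)) (_≡ H) (_≟ᴬ H) ≡ weight H) (extend-dropLast H H-simple) (begin
    Pr (bind (process m) (step m)) _ (_≟ᴬ extend M S)
      ≡⟨ Pr-bind-∝ (_≟ᴬ extend M S) (_≟ᴬ M) c (step m) (λ M′ → Pr-step m M′ M S) (process m) ⟩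
    c *ℚ Pr (process m) (_≡ M) (_≟ᴬ M)
      ≡⟨ cong (c *ℚ_) (Pr-process≡weight m M (dropLast-simple H H-simple)) ⟩
    c *ℚ weight M
      ≡⟨ sym (weight-extend M S) ⟩
    weight (extend M S) ∎)
  where
  open ≡-Reasoning
  M = dropLast H
  S = lastNeighbours H
  c = recip (suc m) *ℚ recip (m C ∣ S ∣)

mainTheorem6 : (t : ℕ) → 1 ≤ t → (G : Adj t) → IsSimple G →
    likelihood G ≡ sumℚ (map weight (ℋ G))
mainTheorem6 t _ G G-simple = begin
  Pr (process t) (_≅ G) (_≅? G)
    ≡⟨ Pr-total _≟ᴬ_ (_≅? G) (allAdj t) (allAdj-enumerates t) (process t) ⟩
  ∑[ H ∈ ℋ G ] Pr (process t) (_≡ H) (_≟ᴬ H)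
    ≡⟨ ∑-filter-cong (_≅? G) (allAdj t) (λ H H≅G → Pr-process≡weight t H (simple-≅ H G H≅G G-simple)) ⟩
  ∑ (ℋ G) weight ∎
  where open ≡-Reasoning
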